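{- For every integer $r \ge 3$, positive integers $s_1 \le s_2 \le \ldots \le s_r$, and every positive integer $n$, $$\mathrm{ex}(n, K_r, K_{s_1,s_2,\ldots, s_r}) \ge \left\lfloor \frac{n}{2} \right\rfloor \cdot \mathrm{ex}\left(\left\lceil \frac{n}{2} \right\rceil, K_{r-1}, K_{s_1,s_2,\ldots, s_{r-1}}\right).$$
   Context: For graphs $F$ and $H$, the generalized Turán number $\mathrm{ex}(n,F,H)$ is the maximum number of copies of $F$ in an $n$-vertex graph containing no subgraph isomorphic to $H$. $K_r$ is the complete graph on $r$ vertices and $K_{s_1,\ldots,s_k}$ is the complete $k$-partite graph with parts of sizes $s_1,\ldots,s_k$. -}

module Defs where

open import Data.Bool using (Bool; true; false; _∧_; _∨_; not; if_then_else_)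
open import Data.Nat using (ℕ; zero; suc; _+_; _≡ᵇ_)
open import Data.Fin using (Fin)
open import Data.Fin.Properties using (_≟_)
open import Data.Fin.Subset using (Subset; inside; outside; ∣_∣)
open import Data.Vec using (Vec; []; _∷_; lookup)
open import Data.List using (List; []; _∷_; _++_; map; allFin)
open import Data.Product using (Σ; Σ-syntax; ∃; _×_; proj₁)
open import Function.Definitions using (Injective)
open import Relation.Binary.PropositionalEquality using (_≡_; _≢_)
open import Relation.Nullary using (¬_)
open import Relation.Nullary.Decidable using (⌊_⌋)

record Graph (n : ℕ) : Set where
  field
    adj     : Fin n → Fin n → Bool
    sym     : ∀ i j → adj i j ≡ adj j i
    irrefl  : ∀ i → adj i i ≡ false
open Graph public

allSubsets : (n : ℕ) → List (Subset n)
allSubsets zero    = [] ∷ []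
allSubsets (suc n) = map (inside ∷_) (allSubsets n) ++ map (outside ∷_) (allSubsets n)

allB : ∀ {A : Set} → (A → Bool) → List A → Bool
allB p []       = true
allB p (x ∷ xs) = p x ∧ allB p xs

isCliqueB : ∀ {n} → Graph n → Subset n → Bool
isCliqueB {n} G S =
  allB (λ i → allB (λ j → not (lookup S i ∧ lookup S j ∧ not ⌊ i ≟ j ⌋) ∨ adj G i j) (allFin n)) (allFin n)

count : ∀ {A : Set} → (A → Bool) → List A → ℕ
count p []       = zero
count p (x ∷ xs) = (if p x then 1 else 0) + count p xs

#K : ∀ {n} → ℕ → Graph n → ℕ
#K {n} k G = count (λ S → (∣ S ∣ ≡ᵇ k) ∧ isCliqueB G S) (allSubsets n)

-- Vertices of the complete p-partite graph K_{s_1,...,s_p}: pairs (part, index in part);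
-- two vertices are adjacent iff they lie in different parts.
MPVertex : ∀ {p} → (Fin p → ℕ) → Set
MPVertex {p} s = Σ[ i ∈ Fin p ] Fin (s i)

ContainsMP : ∀ {n p} → Graph n → (Fin p → ℕ) → Set
ContainsMP {n} G s =
  Σ[ f ∈ (MPVertex s → Fin n) ]
    (Injective _≡_ _≡_ f ×
     (∀ u v → proj₁ u ≢ proj₁ v → adj G (f u) (f v) ≡ true))

MPFree : ∀ {n p} → Graph n → (Fin p → ℕ) → Set
MPFree G s = ¬ ContainsMP G s

IsEx : (n k : ℕ) → ∀ {p} → (Fin p → ℕ) → ℕ → Set
IsEx n k s m =
  (Σ[ G ∈ Graph n ] (MPFree G s × #K k G ≡ m)) ×
  (∀ (G : Graph n) → MPFree G s → #K k G Data.Nat.≤ m)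

{-# OPTIONS --safe #-}
-- Join an extremal K_{s₁,…,s_{r-1}}-free graph H on ⌈n/2⌉ vertices completely to an
-- independent set of ⌊n/2⌋ vertices.  Every independent vertex together with every
-- K_{r-1} of H spans a K_r, which gives ⌊n/2⌋ · ex(⌈n/2⌉, K_{r-1}, K_{s₁,…,s_{r-1}})
-- copies of K_r.  In a copy of K_{s₁,…,s_r} in the join, vertices of different parts are
-- adjacent, so all independent vertices of the copy lie in a single part; deleting that
-- part leaves a complete (r-1)-partite graph inside H whose parts, as the sᵢ are sorted,
-- are at least s₁,…,s_{r-1}.  Hence the join is K_{s₁,…,s_r}-free.
module Submission where

open import Defs
open import Data.Nat using (ℕ; suc; _≤_; _*_; ⌊_/2⌋; ⌈_/2⌉)
open import Data.Fin using (Fin; inject₁)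
open import Function using (_∘_)

open import Data.Bool using (Bool; true; false; _∧_; _∨_; not; if_then_else_)
open import Data.Bool.Properties using (¬-not) renaming (_≟_ to _≟ᵇ_)
open import Data.Nat using (zero; _+_; _≡ᵇ_; z≤n; s≤s)
open import Data.Nat.Properties
  using (≤-refl; ≤-reflexive; ≤-trans; +-mono-≤; +-assoc; m≤n+m; n≤1+n; ⌊n/2⌋+⌈n/2⌉≡n; module ≤-Reasoning)
open import Data.Fin using (zero; suc; punchIn; inject≤; _↑ʳ_) renaming (_≤_ to _≤ᶠ_)
open import Data.Fin.Properties
  using (any?; punchIn-injective; punchInᵢ≢i; inject≤-injective; toℕ-inject₁) renaming (_≟_ to _≟ᶠ_)
open import Data.Fin.Subset using (Subset; inside; outside; ∣_∣)
open import Data.Vec using (_∷_; lookup; replicate) renaming (_++_ to _++ᵛ_)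
open import Data.List using ([]; _∷_; _++_; map)
open import Data.List.Relation.Unary.All using (All; []; _∷_)
open import Data.List.Relation.Unary.All.Properties using (tabulate⁺; tabulate⁻)
open import Data.Product using (Σ-syntax; ∃; _×_; _,_; proj₁; proj₂; map₂)
open import Data.Product.Properties using (,-injectiveˡ)
open import Data.Product.Properties.WithK using (,-injectiveʳ)
open import Function.Definitions using (Injective)
open import Relation.Nullary using (¬_; Dec; yes; no; contradiction)
open import Relation.Nullary.Decidable using (⌊_⌋)
open import Relation.Unary using (Decidable)
open import Relation.Binary.PropositionalEquality
  using (_≡_; _≢_; refl; trans; cong; cong₂; module ≡-Reasoning) renaming (sym to ≡-sym)

∧-true⁻ : ∀ {x y} → x ∧ y ≡ true → x ≡ true × y ≡ true
∧-true⁻ {true} y≡true = refl , y≡true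

∧-true⁺ : ∀ {x y} → x ≡ true → y ≡ true → x ∧ y ≡ true
∧-true⁺ refl refl = refl

∧-mono-true : ∀ {x y x′ y′} → (x ≡ true → x′ ≡ true) → (y ≡ true → y′ ≡ true) →
              x ∧ y ≡ true → x′ ∧ y′ ≡ true
∧-mono-true x⇒x′ y⇒y′ x∧y = ∧-true⁺ (x⇒x′ (proj₁ (∧-true⁻ x∧y))) (y⇒y′ (proj₂ (∧-true⁻ x∧y)))

allB⇒All : ∀ {A : Set} {p : A → Bool} xs → allB p xs ≡ true → All (λ x → p x ≡ true) xs
allB⇒All []       _ = []
allB⇒All (x ∷ xs) e = proj₁ (∧-true⁻ e) ∷ allB⇒All xs (proj₂ (∧-true⁻ e))

All⇒allB : ∀ {A : Set} {p : A → Bool} {xs} → All (λ x → p x ≡ true) xs → allB p xs ≡ true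
All⇒allB []         = refl
All⇒allB (px ∷ pxs) = ∧-true⁺ px (All⇒allB pxs)

record IsClique {n} (G : Graph n) (S : Subset n) : Set where
  constructor isClique
  field adjacent : ∀ i j → lookup S i ≡ true → lookup S j ≡ true → i ≢ j → adj G i j ≡ true
open IsClique

module _ {P : Set} where

  pairB-sound : ∀ {x y a} (d : Dec P) → not (x ∧ y ∧ not ⌊ d ⌋) ∨ a ≡ true →
                x ≡ true → y ≡ true → ¬ P → a ≡ true
  pairB-sound (yes p) _ refl refl ¬p = contradiction p ¬p
  pairB-sound (no _)  e refl refl _  = e

  pairB-complete : ∀ x y a (d : Dec P) → (x ≡ true → y ≡ true → ¬ P → a ≡ true) →
                   not (x ∧ y ∧ not ⌊ d ⌋) ∨ a ≡ true
  pairB-complete false _     _ _       _ = refl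
  pairB-complete true  false _ _       _ = refl
  pairB-complete true  true  _ (yes _) _ = refl
  pairB-complete true  true  _ (no ¬p) h = h refl refl ¬p

isCliqueB-sound : ∀ {n} (G : Graph n) S → isCliqueB G S ≡ true → IsClique G S
isCliqueB-sound G S e = isClique λ i j →
  pairB-sound (i ≟ᶠ j) (tabulate⁻ (allB⇒All _ (tabulate⁻ (allB⇒All _ e) i)) j)

isCliqueB-complete : ∀ {n} (G : Graph n) S → IsClique G S → isCliqueB G S ≡ true
isCliqueB-complete G S clique =
  All⇒allB (tabulate⁺ λ i → All⇒allB (tabulate⁺ λ j →
    pairB-complete (lookup S i) (lookup S j) (adj G i j) _ (adjacent clique i j)))

isKCliqueB : ∀ {n} → ℕ → Graph n → Subset n → Bool
isKCliqueB k G S = (∣ S ∣ ≡ᵇ k) ∧ isCliqueB G S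

module _ {n} {G : Graph (suc n)} {G⁻ : Graph n}
         (restrict : ∀ i j → adj G (suc i) (suc j) ≡ adj G⁻ i j) where

  IsClique-outside∷ : ∀ {S} → IsClique G⁻ S → IsClique G (outside ∷ S)
  IsClique-outside∷ clique = isClique λ where
    (suc i) (suc j) i∈S j∈S i≢j → trans (restrict i j) (adjacent clique i j i∈S j∈S (i≢j ∘ cong suc))

  IsClique-inside∷ : ∀ {S} → (∀ j → lookup S j ≡ true → adj G zero (suc j) ≡ true) →
                     IsClique G⁻ S → IsClique G (inside ∷ S)
  IsClique-inside∷ cone clique = isClique λ where
    zero    zero    _   _   0≢0 → contradiction refl 0≢0
    zero    (suc j) _   j∈S _   → cone j j∈S
    (suc i) zero    i∈S _   _   → trans (Graph.sym G (suc i) zero) (cone i i∈S)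
    (suc i) (suc j) i∈S j∈S i≢j → trans (restrict i j) (adjacent clique i j i∈S j∈S (i≢j ∘ cong suc))

  isKCliqueB-outside∷ : ∀ {k} S → isKCliqueB k G⁻ S ≡ true → isKCliqueB k G (outside ∷ S) ≡ true
  isKCliqueB-outside∷ {k} S =
    ∧-mono-true {∣ S ∣ ≡ᵇ k} (λ ∣S∣≡k → ∣S∣≡k)
      (isCliqueB-complete G (outside ∷ S) ∘ IsClique-outside∷ ∘ isCliqueB-sound G⁻ S)

count-++ : ∀ {A : Set} (p : A → Bool) xs ys → count p (xs ++ ys) ≡ count p xs + count p ys
count-++ p []       ys = refl
count-++ p (x ∷ xs) ys = trans (cong (b +_) (count-++ p xs ys)) (≡-sym (+-assoc b _ _))
  where b = if p x then 1 else 0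

count-map : ∀ {A B : Set} (p : B → Bool) (f : A → B) xs → count p (map f xs) ≡ count (p ∘ f) xs
count-map p f []       = refl
count-map p f (x ∷ xs) = cong (_ +_) (count-map p f xs)

indicator-mono : ∀ {x y} → (x ≡ true → y ≡ true) → (if x then 1 else 0) ≤ (if y then 1 else 0)
indicator-mono {false} _   = z≤n
indicator-mono {true}  x⇒y rewrite x⇒y refl = ≤-refl

count-mono : ∀ {A : Set} {p q : A → Bool} → (∀ x → p x ≡ true → q x ≡ true) →
             ∀ xs → count p xs ≤ count q xs
count-mono p⇒q []       = z≤n
count-mono p⇒q (x ∷ xs) = +-mono-≤ (indicator-mono (p⇒q x)) (count-mono p⇒q xs)

count-allSubsets-suc : ∀ {n} (p : Subset (suc n) → Bool) →
  count p (allSubsets (suc n)) ≡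
  count (p ∘ (inside ∷_)) (allSubsets n) + count (p ∘ (outside ∷_)) (allSubsets n)
count-allSubsets-suc {n} p =
  trans (count-++ p (map (inside ∷_) (allSubsets n)) (map (outside ∷_) (allSubsets n)))
        (cong₂ _+_ (count-map p (inside ∷_) (allSubsets n)) (count-map p (outside ∷_) (allSubsets n)))

count-allSubsets-padding : ∀ {c} k (p : Subset (k + c) → Bool) →
  count (p ∘ (replicate k outside ++ᵛ_)) (allSubsets c) ≤ count p (allSubsets (k + c))
count-allSubsets-padding zero    p = ≤-refl
count-allSubsets-padding {c} (suc k) p = begin
  count (p ∘ (outside ∷_) ∘ (replicate k outside ++ᵛ_)) (allSubsets c)
    ≤⟨ count-allSubsets-padding k (p ∘ (outside ∷_)) ⟩
  count (p ∘ (outside ∷_)) (allSubsets (k + c))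
    ≤⟨ m≤n+m _ _ ⟩
  count (p ∘ (inside ∷_)) (allSubsets (k + c)) + count (p ∘ (outside ∷_)) (allSubsets (k + c))
    ≡⟨ ≡-sym (count-allSubsets-suc p) ⟩
  count p (allSubsets (suc k + c)) ∎
  where open ≤-Reasoning

is↑ʳ : ∀ {c} k → Fin (k + c) → Bool
is↑ʳ zero    _       = true
is↑ʳ (suc k) zero    = false
is↑ʳ (suc k) (suc i) = is↑ʳ k i

is↑ʳ⇒↑ʳ : ∀ {c} k (i : Fin (k + c)) → is↑ʳ k i ≡ true → ∃ λ y → k ↑ʳ y ≡ i
is↑ʳ⇒↑ʳ zero    i       _ = i , refl
is↑ʳ⇒↑ʳ (suc k) (suc i) e = map₂ (cong suc) (is↑ʳ⇒↑ʳ k i e)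

module _ {c} (H : Graph c) where

  joinAdj : ∀ k → Fin (k + c) → Fin (k + c) → Bool
  joinAdj zero    i       j       = adj H i j
  joinAdj (suc k) zero    zero    = false
  joinAdj (suc k) zero    (suc j) = is↑ʳ k j
  joinAdj (suc k) (suc i) zero    = is↑ʳ k i
  joinAdj (suc k) (suc i) (suc j) = joinAdj k i j

  joinAdj-sym : ∀ k i j → joinAdj k i j ≡ joinAdj k j i
  joinAdj-sym zero    i       j       = Graph.sym H i j
  joinAdj-sym (suc k) zero    zero    = refl
  joinAdj-sym (suc k) zero    (suc j) = refl
  joinAdj-sym (suc k) (suc i) zero    = refl
  joinAdj-sym (suc k) (suc i) (suc j) = joinAdj-sym k i j

  joinAdj-irrefl : ∀ k i → joinAdj k i i ≡ false
  joinAdj-irrefl zero    i       = irrefl H i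
  joinAdj-irrefl (suc k) zero    = refl
  joinAdj-irrefl (suc k) (suc i) = joinAdj-irrefl k i

  joinAdj-independent : ∀ k i j → is↑ʳ k i ≡ false → is↑ʳ k j ≡ false → joinAdj k i j ≡ false
  joinAdj-independent (suc k) zero    zero    _ _ = refl
  joinAdj-independent (suc k) zero    (suc j) _ e = e
  joinAdj-independent (suc k) (suc i) zero    e _ = e
  joinAdj-independent (suc k) (suc i) (suc j) e e′ = joinAdj-independent k i j e e′

  joinAdj-↑ʳ : ∀ k x y → joinAdj k (k ↑ʳ x) (k ↑ʳ y) ≡ adj H x y
  joinAdj-↑ʳ zero    x y = refl
  joinAdj-↑ʳ (suc k) x y = joinAdj-↑ʳ k x y

-- The join of the empty graph on k vertices with H: the vertices i ↑ˡ c are pairwise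
-- non-adjacent and adjacent to every vertex k ↑ʳ y, and the latter span a copy of H.
emptyJoin : ∀ {c} k → Graph c → Graph (k + c)
emptyJoin k H = record { adj = joinAdj H k ; sym = joinAdj-sym H k ; irrefl = joinAdj-irrefl H k }

∣padding∣ : ∀ {c} k (T : Subset c) → ∣ replicate k outside ++ᵛ T ∣ ≡ ∣ T ∣
∣padding∣ zero    T = refl
∣padding∣ (suc k) T = ∣padding∣ k T

module _ {c} (H : Graph c) where

  emptyJoin-suc : ∀ k i j → adj (emptyJoin (suc k) H) (suc i) (suc j) ≡ adj (emptyJoin k H) i j
  emptyJoin-suc k i j = refl

  IsClique-padding : ∀ k {T} → IsClique H T → IsClique (emptyJoin k H) (replicate k outside ++ᵛ T)
  IsClique-padding zero    clique = clique
  IsClique-padding (suc k) clique = IsClique-outside∷ (emptyJoin-suc k) (IsClique-padding k clique)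

  lookup-padding : ∀ k (T : Subset c) j → lookup (replicate k outside ++ᵛ T) j ≡ true → is↑ʳ k j ≡ true
  lookup-padding zero    T j       _ = refl
  lookup-padding (suc k) T (suc j) e = lookup-padding k T j e

  isKCliqueB-cone : ∀ m k T → isKCliqueB m H T ≡ true →
                    isKCliqueB (suc m) (emptyJoin (suc k) H) (inside ∷ replicate k outside ++ᵛ T) ≡ true
  isKCliqueB-cone m k T =
    ∧-mono-true {∣ T ∣ ≡ᵇ m} (trans (cong (_≡ᵇ m) (∣padding∣ k T)))
      (isCliqueB-complete (emptyJoin (suc k) H) (inside ∷ replicate k outside ++ᵛ T)
         ∘ IsClique-inside∷ (emptyJoin-suc k) (lookup-padding k T)
         ∘ IsClique-padding k ∘ isCliqueB-sound H T)

#K-emptyJoin : ∀ {c} m k (H : Graph c) → k * #K m H ≤ #K (suc m) (emptyJoin k H)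
#K-emptyJoin m zero    H = z≤n
#K-emptyJoin {c} m (suc k) H = begin
  #K m H + k * #K m H
    ≤⟨ +-mono-≤ containing-0 (≤-trans (#K-emptyJoin m k H) avoiding-0) ⟩
  count (P ∘ (inside ∷_)) (allSubsets (k + c)) + count (P ∘ (outside ∷_)) (allSubsets (k + c))
    ≡⟨ ≡-sym (count-allSubsets-suc P) ⟩
  #K (suc m) (emptyJoin (suc k) H) ∎
  where
  open ≤-Reasoning
  P : Subset (suc k + c) → Bool
  P = isKCliqueB (suc m) (emptyJoin (suc k) H)

  containing-0 : #K m H ≤ count (P ∘ (inside ∷_)) (allSubsets (k + c))
  containing-0 = ≤-trans (count-mono (isKCliqueB-cone H m k) (allSubsets c))
                         (count-allSubsets-padding k (P ∘ (inside ∷_)))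

  avoiding-0 : #K (suc m) (emptyJoin k H) ≤ count (P ∘ (outside ∷_)) (allSubsets (k + c))
  avoiding-0 = count-mono (isKCliqueB-outside∷ {G = emptyJoin (suc k) H} {emptyJoin k H} (emptyJoin-suc H k)) (allSubsets (k + c))

module _ {n} {G : Graph n} where

  ContainsMP-reindex : ∀ {p q} {s : Fin p → ℕ} {t : Fin q → ℕ} (φ : MPVertex t → MPVertex s) →
    Injective _≡_ _≡_ φ → (∀ u v → proj₁ u ≢ proj₁ v → proj₁ (φ u) ≢ proj₁ (φ v)) →
    ContainsMP G s → ContainsMP G t
  ContainsMP-reindex φ φ-inj φ-parts (f , f-inj , f-adj) =
    f ∘ φ , φ-inj ∘ f-inj , λ u v → f-adj (φ u) (φ v) ∘ φ-parts u v

  ContainsMP-mono : ∀ {p} {s t : Fin p → ℕ} → (∀ i → t i ≤ s i) → ContainsMP G s → ContainsMP G t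
  ContainsMP-mono {s = s} {t} t≤s = ContainsMP-reindex shrink shrink-injective (λ _ _ i≢j → i≢j)
    where
    shrink : MPVertex t → MPVertex s
    shrink (i , x) = i , inject≤ x (t≤s i)

    shrink-injective : Injective _≡_ _≡_ shrink
    shrink-injective {i , x} {_ , y} eq with refl ← ,-injectiveˡ eq =
      cong (i ,_) (inject≤-injective _ _ x y (,-injectiveʳ eq))

  ContainsMP-dropPart : ∀ {m} {s : Fin (suc m) → ℕ} i → ContainsMP G s → ContainsMP G (s ∘ punchIn i)
  ContainsMP-dropPart {s = s} i = ContainsMP-reindex dropPart dropPart-injective
                            (λ u v i≢j → i≢j ∘ punchIn-injective i (proj₁ u) (proj₁ v))
    where
    dropPart : MPVertex (s ∘ punchIn i) → MPVertex s
    dropPart (j , x) = punchIn i j , x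

    dropPart-injective : Injective _≡_ _≡_ dropPart
    dropPart-injective {j , x} {k , y} eq with refl ← punchIn-injective i j k (,-injectiveˡ eq) =
      cong (j ,_) (,-injectiveʳ eq)

  ContainsMP-pullback : ∀ {c q} {H : Graph c} {t : Fin q → ℕ} (e : Fin c → Fin n) →
    (∀ x y → adj G (e x) (e y) ≡ adj H x y) →
    (K : ContainsMP G t) → (∀ u → ∃ λ y → e y ≡ proj₁ K u) → ContainsMP H t
  ContainsMP-pullback {H = H} e e-adj (f , f-inj , f-adj) f∈e = g , g-inj , g-adj
    where
    g = λ u → proj₁ (f∈e u)
    e∘g≡f = λ u → proj₂ (f∈e u)

    g-inj : Injective _≡_ _≡_ g
    g-inj {u} {v} eq = f-inj (trans (≡-sym (e∘g≡f u)) (trans (cong e eq) (e∘g≡f v)))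

    g-adj : ∀ u v → proj₁ u ≢ proj₁ v → adj H (g u) (g v) ≡ true
    g-adj u v u≢v = begin
      adj H (g u) (g v)         ≡⟨ ≡-sym (e-adj (g u) (g v)) ⟩
      adj G (e (g u)) (e (g v)) ≡⟨ cong₂ (adj G) (e∘g≡f u) (e∘g≡f v) ⟩
      adj G (f u) (f v)         ≡⟨ f-adj u v u≢v ⟩
      true                      ∎
      where open ≡-Reasoning

  independent-within-one-part : ∀ {m} {s : Fin (suc m) → ℕ} {I : Fin n → Set} → Decidable I →
    (∀ x y → I x → I y → adj G x y ≡ false) →
    (K : ContainsMP G s) → Σ[ i₀ ∈ Fin (suc m) ] (∀ u → proj₁ u ≢ i₀ → ¬ I (proj₁ K u))
  independent-within-one-part I? independent (f , _ , f-adj)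
    with any? (λ i → any? (λ x → I? (f (i , x))))
  ... | yes (i₀ , x₀ , Iu₀) = i₀ , λ u u≢i₀ Iu →
          contradiction (trans (≡-sym (f-adj u (i₀ , x₀) u≢i₀)) (independent _ _ Iu Iu₀)) λ ()
  ... | no none = zero , λ u _ Iu → none (proj₁ u , proj₂ u , Iu)

Sorted : ∀ {p} → (Fin p → ℕ) → Set
Sorted s = ∀ i j → i ≤ᶠ j → s i ≤ s j

inject₁≤punchIn : ∀ {m} (i : Fin (suc m)) j → inject₁ j ≤ᶠ punchIn i j
inject₁≤punchIn zero    j       = ≤-trans (≤-reflexive (toℕ-inject₁ j)) (n≤1+n _)
inject₁≤punchIn (suc i) zero    = z≤n
inject₁≤punchIn (suc i) (suc j) = s≤s (inject₁≤punchIn i j)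

emptyJoin-free : ∀ {c m} {H : Graph c} {s : Fin (suc m) → ℕ} k → Sorted s →
                 MPFree H (s ∘ inject₁) → MPFree (emptyJoin k H) s
emptyJoin-free {H = H} {s} k sorted H-free K =
  H-free (ContainsMP-mono {G = H} (λ j → sorted _ _ (inject₁≤punchIn i₀ j)) K∖i₀)
  where
  G = emptyJoin k H

  i₀-part = independent-within-one-part {G = G} (λ x → is↑ʳ k x ≟ᵇ false) (joinAdj-independent H k) K
  i₀ = proj₁ i₀-part

  K∖i₀ : ContainsMP H (s ∘ punchIn i₀)
  K∖i₀ = ContainsMP-pullback {G = G} {H = H} {t = s ∘ punchIn i₀} (k ↑ʳ_) (joinAdj-↑ʳ H k)
           (ContainsMP-dropPart {G = G} i₀ K)
           λ (j , x) → is↑ʳ⇒↑ʳ k _ (¬-not (proj₂ i₀-part (punchIn i₀ j , x) (punchInᵢ≢i i₀ j)))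

IsEx-bound : ∀ {n n′ k p a} {s : Fin p → ℕ} → n′ ≡ n → IsEx n k s a →
             (G : Graph n′) → MPFree G s → #K k G ≤ a
IsEx-bound refl (_ , maximal) = maximal

-- Here r = suc m.
proposition1p2 : (m : ℕ) → 2 ≤ m →
    (s : Fin (suc m) → ℕ) →
    (∀ i → 1 ≤ s i) →
    (∀ i j → i Data.Fin.≤ j → s i ≤ s j) →
    (n : ℕ) → 1 ≤ n →
    (a b : ℕ) →
    IsEx n (suc m) s a →
    IsEx ⌈ n /2⌉ m (s ∘ inject₁) b →
    ⌊ n /2⌋ * b ≤ a
proposition1p2 m _ s _ sorted n _ a b ex-n ((H , H-free , #H≡b) , _) = begin
  ⌊ n /2⌋ * b                      ≡⟨ cong (⌊ n /2⌋ *_) (≡-sym #H≡b) ⟩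
  ⌊ n /2⌋ * #K m H                 ≤⟨ #K-emptyJoin m ⌊ n /2⌋ H ⟩
  #K (suc m) (emptyJoin ⌊ n /2⌋ H) ≤⟨ IsEx-bound (⌊n/2⌋+⌈n/2⌉≡n n) ex-n (emptyJoin ⌊ n /2⌋ H)
                                        (emptyJoin-free ⌊ n /2⌋ sorted H-free) ⟩
  a                                ∎
  where open ≤-Reasoning
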